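{- Define integers $a(\ell,d)$ for $\ell,d\ge 0$ by $a(0,d)=4^d$ for all $d\ge0$, $a(\ell,0)=0$ for all $\ell\ge1$, and, for $\ell,d\ge1$, $$a(\ell,d)=4(\ell+1)\,a(\ell,d-1)+\ell\,a(\ell-1,d-1).$$ Then for all $\ell,d\ge0$, $$a(\ell,d)=4^{d-\ell}\sum_{j=0}^{\ell}(-1)^j\binom{\ell}{j}(\ell+1-j)^d.$$ -}

module Defs where

open import Data.Nat as ℕ using (ℕ; zero; suc)
open import Data.Nat.Combinatorics using (_C_)
open import Data.Integer using (ℤ; +_; _+_; _*_; _^_; -1ℤ)
open import Data.List using (List; foldr; map; upTo)

a : ℕ → ℕ → ℤ
a zero d = + (4 ℕ.^ d)
a (suc l) zero = + 0
a (suc l) (suc d) = (+ 4 * + (suc l ℕ.+ 1)) * a (suc l) d + (+ suc l) * a l d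

sumℤ : List ℤ → ℤ
sumℤ = foldr _+_ (+ 0)

S : ℕ → ℕ → ℤ
S ℓ d = sumℤ (map (λ j → (-1ℤ ^ j) * (+ (ℓ C j)) * (+ ((suc ℓ ℕ.∸ j) ℕ.^ d))) (upTo (suc ℓ)))

-- Both sides obey the recursion defining a, up to the factor 4^ℓ.  For the sum
-- S(ℓ,d) = Σⱼ (-1)ʲ C(ℓ,j) (ℓ+1-j)ᵈ this is the recurrence
--   S(ℓ+1,d+1) = (ℓ+2) S(ℓ+1,d) + (ℓ+1) S(ℓ,d),
-- obtained by writing (ℓ+2-j)ᵈ⁺¹ = (ℓ+2)(ℓ+2-j)ᵈ - j (ℓ+2-j)ᵈ and absorbing the
-- factor j with j C(ℓ+1,j) = (ℓ+1) C(ℓ,j-1); the boundary values are S(0,d) = 1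
-- and S(ℓ+1,0) = 0, the vanishing alternating sum of a row of Pascal's triangle,
-- which telescopes by Pascal's rule.
module Submission where

open import Defs
open import Data.Nat as ℕ using (ℕ; zero; suc; _∸_; z≤n; s≤s)
import Data.Nat.Properties as ℕₚ
open import Data.Nat.Combinatorics using (_C_; nC1≡n; k>n⇒nCk≡0; nCk+nC[k+1]≡[n+1]C[k+1])
open import Data.Nat.Tactic.RingSolver as ℕ-Solver using ()
open import Data.Integer using (ℤ; +_; _+_; _-_; -_; _*_; _^_; -1ℤ; 0ℤ; 1ℤ)
import Data.Integer.Properties as ℤₚ
open import Data.Integer.Tactic.RingSolver using (solve-∀)
open import Data.Fin using (Fin; toℕ)
open import Data.Fin.Properties using (toℕ≤pred[n])
open import Data.List using (map; applyUpTo)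
open import Algebra.Properties.Semiring.Sum ℤₚ.+-*-semiring
  using (sum-syntax; sum⁺-syntax; sum-cong-≗; ∑-distrib-+; *-distribˡ-sum)
open import Function using (id)
open import Relation.Binary.PropositionalEquality using (_≡_; refl; sym; trans; cong; cong₂; module ≡-Reasoning)

[k+1]*[n+1]C[k+1]≡[n+1]*nCk : ∀ n k → suc k ℕ.* (suc n C suc k) ≡ suc n ℕ.* (n C k)
[k+1]*[n+1]C[k+1]≡[n+1]*nCk zero zero = refl
[k+1]*[n+1]C[k+1]≡[n+1]*nCk zero (suc k) =
  trans (cong (suc (suc k) ℕ.*_) (k>n⇒nCk≡0 (s≤s (s≤s (z≤n {k})))))
        (trans (ℕₚ.*-zeroʳ (suc (suc k))) (sym (cong (1 ℕ.*_) (k>n⇒nCk≡0 (s≤s (z≤n {k}))))))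
[k+1]*[n+1]C[k+1]≡[n+1]*nCk (suc n) zero =
  trans (ℕₚ.*-identityˡ _) (trans (nC1≡n (suc (suc n))) (sym (ℕₚ.*-identityʳ (suc (suc n)))))
[k+1]*[n+1]C[k+1]≡[n+1]*nCk (suc n) (suc k) = begin
  suc (suc k) ℕ.* (suc (suc n) C suc (suc k))
    ≡⟨ cong (suc (suc k) ℕ.*_) (nCk+nC[k+1]≡[n+1]C[k+1] (suc n) (suc k)) ⟨
  suc (suc k) ℕ.* (suc n C suc k ℕ.+ suc n C suc (suc k))
    ≡⟨ split (suc k) (suc n C suc k) (suc n C suc (suc k)) ⟩
  suc k ℕ.* (suc n C suc k) ℕ.+ suc n C suc k ℕ.+ suc (suc k) ℕ.* (suc n C suc (suc k))
    ≡⟨ cong₂ (λ x y → x ℕ.+ suc n C suc k ℕ.+ y)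
             ([k+1]*[n+1]C[k+1]≡[n+1]*nCk n k) ([k+1]*[n+1]C[k+1]≡[n+1]*nCk n (suc k)) ⟩
  suc n ℕ.* (n C k) ℕ.+ suc n C suc k ℕ.+ suc n ℕ.* (n C suc k)
    ≡⟨ cong (λ x → suc n ℕ.* (n C k) ℕ.+ x ℕ.+ suc n ℕ.* (n C suc k)) (nCk+nC[k+1]≡[n+1]C[k+1] n k) ⟨
  suc n ℕ.* (n C k) ℕ.+ (n C k ℕ.+ n C suc k) ℕ.+ suc n ℕ.* (n C suc k)
    ≡⟨ merge (suc n) (n C k) (n C suc k) ⟩
  suc (suc n) ℕ.* (n C k ℕ.+ n C suc k)
    ≡⟨ cong (suc (suc n) ℕ.*_) (nCk+nC[k+1]≡[n+1]C[k+1] n k) ⟩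
  suc (suc n) ℕ.* (suc n C suc k)
    ∎
  where
  open ≡-Reasoning
  split : ∀ m x y → suc m ℕ.* (x ℕ.+ y) ≡ m ℕ.* x ℕ.+ x ℕ.+ suc m ℕ.* y
  split = ℕ-Solver.solve-∀
  merge : ∀ m x y → m ℕ.* x ℕ.+ (x ℕ.+ y) ℕ.+ m ℕ.* y ≡ suc m ℕ.* (x ℕ.+ y)
  merge = ℕ-Solver.solve-∀

pos-^ : ∀ m n → + (m ℕ.^ n) ≡ (+ m) ^ n
pos-^ m zero    = refl
pos-^ m (suc n) = trans (ℤₚ.pos-* m (m ℕ.^ n)) (cong (+ m *_) (pos-^ m n))

sumℤ-map-applyUpTo : ∀ (g : ℕ → ℤ) (f : ℕ → ℕ) n →
                     sumℤ (map g (applyUpTo f n)) ≡ ∑[ i < n ] g (f (toℕ i))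
sumℤ-map-applyUpTo g f zero    = refl
sumℤ-map-applyUpTo g f (suc n) = cong (_+_ (g (f 0))) (sumℤ-map-applyUpTo g (λ j → f (suc j)) n)

∑-telescope : ∀ n (f : ℕ → ℤ) → ∑[ i < n ] (f (suc (toℕ i)) - f (toℕ i)) ≡ f n - f 0
∑-telescope zero    f = sym (ℤₚ.+-inverseʳ (f 0))
∑-telescope (suc n) f =
  trans (cong (_+_ (f 1 - f 0)) (∑-telescope n (λ j → f (suc j)))) (cancel (f 1) (f 0) (f (suc n)))
  where
  cancel : ∀ x y z → x - y + (z - x) ≡ z - y
  cancel = solve-∀

alternating-binomial-sum : ∀ n → ∑[ j ≤ suc n ] ((-1ℤ ^ toℕ j) * + (suc n C toℕ j)) ≡ 0ℤ
alternating-binomial-sum n = begin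
  ∑[ j ≤ suc n ] ((-1ℤ ^ toℕ j) * + (suc n C toℕ j))
    ≡⟨⟩
  1ℤ + ∑[ k ≤ n ] ((-1ℤ ^ suc (toℕ k)) * + (suc n C suc (toℕ k)))
    ≡⟨ cong (_+_ 1ℤ) (sum-cong-≗ {suc n} (λ k → pascal (-1ℤ ^ toℕ k) (n C toℕ k) (n C suc (toℕ k))
                                        (nCk+nC[k+1]≡[n+1]C[k+1] n (toℕ k)))) ⟩
  1ℤ + ∑[ k ≤ n ] (c (suc (toℕ k)) - c (toℕ k))
    ≡⟨ cong (_+_ 1ℤ) (∑-telescope (suc n) c) ⟩
  1ℤ + (c (suc n) - 1ℤ)
    ≡⟨ cong (λ x → 1ℤ + ((-1ℤ ^ suc n) * + x - 1ℤ)) (k>n⇒nCk≡0 (ℕₚ.n<1+n n)) ⟩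
  1ℤ + ((-1ℤ ^ suc n) * 0ℤ - 1ℤ)
    ≡⟨ vanish (-1ℤ ^ suc n) ⟩
  0ℤ
    ∎
  where
  open ≡-Reasoning
  c : ℕ → ℤ
  c k = (-1ℤ ^ k) * + (n C k)
  pascal : ∀ s x y {z} → x ℕ.+ y ≡ z → (-1ℤ * s) * + z ≡ (-1ℤ * s) * + y - s * + x
  pascal s x y refl = trans (cong ((-1ℤ * s) *_) (ℤₚ.pos-+ x y)) (shuffle s (+ x) (+ y))
    where
    shuffle : ∀ s x y → (-1ℤ * s) * (x + y) ≡ (-1ℤ * s) * y - s * x
    shuffle = solve-∀
  vanish : ∀ s → 1ℤ + (s * 0ℤ - 1ℤ) ≡ 0ℤ
  vanish = solve-∀

S-term : ℕ → ℕ → ℕ → ℤ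
S-term ℓ d j = (-1ℤ ^ j) * (+ (ℓ C j)) * (+ ((suc ℓ ∸ j) ℕ.^ d))

S≡∑S-term : ∀ ℓ d → S ℓ d ≡ ∑[ j ≤ ℓ ] S-term ℓ d (toℕ j)
S≡∑S-term ℓ d = sumℤ-map-applyUpTo (S-term ℓ d) id (suc ℓ)

S[0,d]≡1 : ∀ d → S 0 d ≡ 1ℤ
S[0,d]≡1 d rewrite ℕₚ.^-zeroˡ d = refl

S[1+ℓ,0]≡0 : ∀ ℓ → S (suc ℓ) 0 ≡ 0ℤ
S[1+ℓ,0]≡0 ℓ = begin
  S (suc ℓ) 0
    ≡⟨ S≡∑S-term (suc ℓ) 0 ⟩
  ∑[ j ≤ suc ℓ ] S-term (suc ℓ) 0 (toℕ j)
    ≡⟨ sum-cong-≗ {suc (suc ℓ)} (λ j → ℤₚ.*-identityʳ ((-1ℤ ^ toℕ j) * + (suc ℓ C toℕ j))) ⟩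
  ∑[ j ≤ suc ℓ ] ((-1ℤ ^ toℕ j) * + (suc ℓ C toℕ j))
    ≡⟨ alternating-binomial-sum ℓ ⟩
  0ℤ
    ∎
  where open ≡-Reasoning

S-term[n,1+d,j] : ∀ n d j → j ℕ.≤ suc n →
                  S-term n (suc d) j ≡ + suc n * S-term n d j - + j * S-term n d j
S-term[n,1+d,j] n d j j≤1+n =
  trans (cong ((-1ℤ ^ j) * + (n C j) *_) (ℤₚ.pos-* (suc n ∸ j) ((suc n ∸ j) ℕ.^ d)))
        (peel (-1ℤ ^ j) (+ (n C j)) (+ ((suc n ∸ j) ℕ.^ d)) (+ (suc n ∸ j)) (+ j)
              (trans (sym (ℤₚ.pos-+ (suc n ∸ j) j)) (cong +_ (ℕₚ.m∸n+n≡m j≤1+n))))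
  where
  ring : ∀ s b p m j → s * b * (m * p) ≡ (m + j) * (s * b * p) - j * (s * b * p)
  ring = solve-∀
  peel : ∀ s b p m j {N} → m + j ≡ N → s * b * (m * p) ≡ N * (s * b * p) - j * (s * b * p)
  peel s b p m j refl = ring s b p m j

[k+1]*S-term[1+ℓ,d,1+k] : ∀ ℓ d k → - (+ suc k * S-term (suc ℓ) d (suc k)) ≡ + suc ℓ * S-term ℓ d k
[k+1]*S-term[1+ℓ,d,1+k] ℓ d k = begin
  - (K * ((-1ℤ * s) * B * p)) ≡⟨ regroup K B s p ⟩
  (K * B) * (s * p)           ≡⟨ cong (_* (s * p)) absorption ⟩
  (N * b) * (s * p)           ≡⟨ regroup′ N b s p ⟩
  N * (s * b * p)             ∎
  where
  open ≡-Reasoning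
  K = + suc k
  N = + suc ℓ
  B = + (suc ℓ C suc k)
  b = + (ℓ C k)
  s = -1ℤ ^ k
  p = + ((suc ℓ ∸ k) ℕ.^ d)
  absorption : K * B ≡ N * b
  absorption = trans (sym (ℤₚ.pos-* (suc k) (suc ℓ C suc k)))
                     (trans (cong +_ ([k+1]*[n+1]C[k+1]≡[n+1]*nCk ℓ k)) (ℤₚ.pos-* (suc ℓ) (ℓ C k)))
  regroup : ∀ K B s p → - (K * ((-1ℤ * s) * B * p)) ≡ (K * B) * (s * p)
  regroup = solve-∀
  regroup′ : ∀ N b s p → (N * b) * (s * p) ≡ N * (s * b * p)
  regroup′ = solve-∀

∑[j≤1+ℓ]j*S-term : ∀ ℓ d → ∑[ j ≤ suc ℓ ] (- (+ toℕ j * S-term (suc ℓ) d (toℕ j))) ≡ + suc ℓ * S ℓ d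
∑[j≤1+ℓ]j*S-term ℓ d = begin
  ∑[ j ≤ suc ℓ ] (- (+ toℕ j * S-term (suc ℓ) d (toℕ j)))
    ≡⟨⟩
  0ℤ + ∑[ k ≤ ℓ ] (- (+ suc (toℕ k) * S-term (suc ℓ) d (suc (toℕ k))))
    ≡⟨ ℤₚ.+-identityˡ _ ⟩
  ∑[ k ≤ ℓ ] (- (+ suc (toℕ k) * S-term (suc ℓ) d (suc (toℕ k))))
    ≡⟨ sum-cong-≗ {suc ℓ} (λ k → [k+1]*S-term[1+ℓ,d,1+k] ℓ d (toℕ k)) ⟩
  ∑[ k ≤ ℓ ] (+ suc ℓ * S-term ℓ d (toℕ k))
    ≡⟨ *-distribˡ-sum {suc ℓ} (+ suc ℓ) (λ k → S-term ℓ d (toℕ k)) ⟨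
  + suc ℓ * ∑[ k ≤ ℓ ] S-term ℓ d (toℕ k)
    ≡⟨ cong (+ suc ℓ *_) (S≡∑S-term ℓ d) ⟨
  + suc ℓ * S ℓ d
    ∎
  where open ≡-Reasoning

S[1+ℓ,1+d] : ∀ ℓ d → S (suc ℓ) (suc d) ≡ + suc (suc ℓ) * S (suc ℓ) d + + suc ℓ * S ℓ d
S[1+ℓ,1+d] ℓ d = begin
  S n (suc d)
    ≡⟨ S≡∑S-term n (suc d) ⟩
  ∑[ j ≤ n ] S-term n (suc d) (toℕ j)
    ≡⟨ sum-cong-≗ {suc n} (λ j → S-term[n,1+d,j] n d (toℕ j) (ℕₚ.m≤n⇒m≤1+n (toℕ≤pred[n] j))) ⟩
  ∑[ j ≤ n ] (+ suc n * t j - + toℕ j * t j)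
    ≡⟨ ∑-distrib-+ {suc n} (λ j → + suc n * t j) (λ j → - (+ toℕ j * t j)) ⟩
  ∑[ j ≤ n ] (+ suc n * t j) + ∑[ j ≤ n ] (- (+ toℕ j * t j))
    ≡⟨ cong₂ _+_ (sym (*-distribˡ-sum {suc n} (+ suc n) t)) (∑[j≤1+ℓ]j*S-term ℓ d) ⟩
  + suc n * ∑[ j ≤ n ] t j + + suc ℓ * S ℓ d
    ≡⟨ cong (λ x → + suc n * x + + suc ℓ * S ℓ d) (S≡∑S-term n d) ⟨
  + suc n * S n d + + suc ℓ * S ℓ d
    ∎
  where
  open ≡-Reasoning
  n = suc ℓ
  t : Fin (suc n) → ℤ
  t j = S-term n d (toℕ j)

mainTheorem1 : (ℓ d : ℕ) → ((+ 4) ^ ℓ) * a ℓ d ≡ ((+ 4) ^ d) * S ℓ d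
mainTheorem1 zero d = begin
  1ℤ * + (4 ℕ.^ d)    ≡⟨ ℤₚ.*-identityˡ _ ⟩
  + (4 ℕ.^ d)         ≡⟨ pos-^ 4 d ⟩
  (+ 4) ^ d             ≡⟨ ℤₚ.*-identityʳ _ ⟨
  (+ 4) ^ d * 1ℤ        ≡⟨ cong ((+ 4) ^ d *_) (S[0,d]≡1 d) ⟨
  (+ 4) ^ d * S zero d  ∎
  where open ≡-Reasoning
mainTheorem1 (suc ℓ) zero = begin
  (+ 4) ^ suc ℓ * 0ℤ    ≡⟨ ℤₚ.*-zeroʳ ((+ 4) ^ suc ℓ) ⟩
  1ℤ * 0ℤ             ≡⟨ cong (1ℤ *_) (S[1+ℓ,0]≡0 ℓ) ⟨
  1ℤ * S (suc ℓ) zero ∎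
  where open ≡-Reasoning
mainTheorem1 (suc ℓ) (suc d) = begin
  (+ 4) ^ suc ℓ * a (suc ℓ) (suc d)
    ≡⟨⟩
  (+ 4 * p) * ((+ 4 * + (suc ℓ ℕ.+ 1)) * a (suc ℓ) d + + suc ℓ * a ℓ d)
    ≡⟨ cong (λ m → (+ 4 * p) * ((+ 4 * + m) * a (suc ℓ) d + + suc ℓ * a ℓ d)) (ℕₚ.+-comm (suc ℓ) 1) ⟩
  (+ 4 * p) * ((+ 4 * M) * a (suc ℓ) d + N * a ℓ d)
    ≡⟨ expand p M N (a (suc ℓ) d) (a ℓ d) ⟩
  (+ 4 * M) * ((+ 4 * p) * a (suc ℓ) d) + (+ 4 * N) * (p * a ℓ d)
    ≡⟨ cong₂ (λ x y → (+ 4 * M) * x + (+ 4 * N) * y) (mainTheorem1 (suc ℓ) d) (mainTheorem1 ℓ d) ⟩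
  (+ 4 * M) * (q * S (suc ℓ) d) + (+ 4 * N) * (q * S ℓ d)
    ≡⟨ collect q M N (S (suc ℓ) d) (S ℓ d) ⟩
  (+ 4 * q) * (M * S (suc ℓ) d + N * S ℓ d)
    ≡⟨ cong ((+ 4 * q) *_) (S[1+ℓ,1+d] ℓ d) ⟨
  (+ 4 * q) * S (suc ℓ) (suc d)
    ∎
  where
  open ≡-Reasoning
  p = (+ 4) ^ ℓ
  q = (+ 4) ^ d
  M = + suc (suc ℓ)
  N = + suc ℓ
  expand : ∀ p M N x y → (+ 4 * p) * ((+ 4 * M) * x + N * y) ≡ (+ 4 * M) * ((+ 4 * p) * x) + (+ 4 * N) * (p * y)
  expand = solve-∀
  collect : ∀ q M N x y → (+ 4 * M) * (q * x) + (+ 4 * N) * (q * y) ≡ (+ 4 * q) * (M * x + N * y)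
  collect = solve-∀
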